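{- In the theory EZF described in the context, let $X\in\mathcal V^*$. Then there exists a unique set $Y$ of EZF satisfying $P(Y)=X$.
   Context: The theory EZF: the language of ZF augmented with a binary relation symbol $\in_1$. $\mathcal{V}$ is the von Neumann universe; its members are Zermelo sets; $\mathcal{V}^*=\mathcal{V}\setminus\{\emptyset\}$. Axioms: ZF minus Power Set, relativized to $\mathcal V$; Extensionality: for $A,B\in\mathcal V$, if $\forall S\in\mathcal V(S\in_1 A\Leftrightarrow S\in_1 B)$ then $A=B$; Powerset: for every object $X$ there is $Y\in\mathcal V$ with $\forall A\in\mathcal V(A\in_1 X\Leftrightarrow A\in Y)$, written $P(X)$; Inverse powerset: for every $Y\in\mathcal V^*$ there is an object $X$ with $\forall A\in\mathcal V(A\in Y\Leftrightarrow A\in_1 X)$, written $P^{ -1}(Y)$; Subset assignment: for $X,A\in\mathcal V$, $\forall x(x\in A\Rightarrow x\in X)\Leftrightarrow A\in_1 X$. EZF is the class of Zermelo sets together with all $P^{ -1}(X)$, $X\in\mathcal V^*$. Extended subset relation: $X\subseteq Y$ iff either ($X,Y\in\mathcal V$ and every $A\in\mathcal V$ with $A\in X$ has $A\in Y$) or (at least one of $X,Y$ is not in $\mathcal V$ and every $A\in\mathcal V$ with $A\in_1 X$ has $A\in_1 Y$).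
   Formalization: Extensionality for ∈₁ is assumed for all objects A, B, not only for A, B ∈ 𝒱, so any two objects with the same Zermelo sets S satisfying S ∈₁ A ⇔ S ∈₁ B are equal. The paper assumes this as well. -}

module Defs where

open import Data.Product using (Σ; _×_; _,_; proj₁; proj₂; ∃)
open import Data.Sum using (_⊎_)
open import Data.Empty using (⊥)
open import Relation.Nullary using (¬_)
open import Relation.Binary.PropositionalEquality using (_≡_)

infix 2 _⇔_
_⇔_ : Set → Set → Set
P ⇔ Q = (P → Q) × (Q → P)

-- Obj is the universe of discourse (all objects),
-- equality of objects is Agda's _≡_, _∈_ and _∈₁_ are the two binary relations,
-- and V is the predicate "is a Zermelo set" (member of the von Neumann universe).
record EZFModel : Set₁ where
  field
    Obj  : Set
    _∈_  : Obj → Obj → Set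
    _∈₁_ : Obj → Obj → Set
    V    : Obj → Set
  infix 5 _∈_ _∈₁_
  field

    V-trans : ∀ {A x} → V A → x ∈ A → V x

    -- ZF minus Power Set, relativized to V (schemes stated second-order)
    zf-ext : ∀ {A B} → V A → V B →
             (∀ x → V x → (x ∈ A ⇔ x ∈ B)) → A ≡ B
    zf-empty : Σ Obj λ e → V e × (∀ x → V x → ¬ (x ∈ e))
    zf-pair : ∀ {a b} → V a → V b →
              Σ Obj λ c → V c × (∀ x → V x → (x ∈ c ⇔ (x ≡ a ⊎ x ≡ b)))
    zf-union : ∀ {A} → V A →
               Σ Obj λ U → V U ×
                 (∀ x → V x → (x ∈ U ⇔ Σ Obj λ B → V B × B ∈ A × x ∈ B))
    zf-infinity : Σ Obj λ I → V I ×
                    ((Σ Obj λ e → V e × e ∈ I × (∀ y → V y → ¬ (y ∈ e))) ×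
                     (∀ x → V x → x ∈ I →
                        Σ Obj λ s → V s × s ∈ I ×
                          (∀ y → V y → (y ∈ s ⇔ (y ∈ x ⊎ y ≡ x)))))
    zf-separation : (φ : Obj → Set) → ∀ {A} → V A →
                    Σ Obj λ B → V B × (∀ x → V x → (x ∈ B ⇔ (x ∈ A × φ x)))
    zf-replacement : (R : Obj → Obj → Set) → ∀ {A} → V A →
                     (∀ x → V x → x ∈ A →
                        Σ Obj λ y → V y × R x y ×
                          (∀ z → V z → R x z → z ≡ y)) →
                     Σ Obj λ B → V B ×
                       (∀ y → V y → (y ∈ B ⇔ Σ Obj λ x → V x × x ∈ A × R x y))
    zf-foundation : ∀ {A} → V A → (Σ Obj λ x → V x × x ∈ A) →
                    Σ Obj λ x → V x × x ∈ A × (∀ y → V y → y ∈ x → ¬ (y ∈ A))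

    extensionality : ∀ A B → (∀ S → V S → (S ∈₁ A ⇔ S ∈₁ B)) → A ≡ B
    powerset : ∀ X → Σ Obj λ Y → V Y × (∀ A → V A → (A ∈₁ X ⇔ A ∈ Y))
    inverse-powerset : ∀ Y → V Y → (Σ Obj λ a → a ∈ Y) →
                       Σ Obj λ X → ∀ A → V A → (A ∈ Y ⇔ A ∈₁ X)
    subset-assignment : ∀ {X A} → V X → V A →
                        ((∀ x → x ∈ A → x ∈ X) ⇔ A ∈₁ X)

  V* : Obj → Set
  V* X = V X × Σ Obj λ a → a ∈ X

  P : Obj → Obj
  P X = proj₁ (powerset X)

  -- membership in the class EZF: Zermelo sets together with all P⁻¹(Z), Z ∈ V*
  -- (P⁻¹(Z) is any object X with ∀A∈V (A∈Z ⇔ A∈₁X); unique by extensionality)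
  InEZF : Obj → Set
  InEZF Y = V Y ⊎ (Σ Obj λ Z → V* Z × (∀ A → V A → (A ∈ Z ⇔ A ∈₁ Y)))

-- P is injective on all objects by ∈₁-extensionality, so uniqueness holds even
-- without restricting to the class EZF; existence is witnessed by P⁻¹(X).
module Submission where

open import Defs
open import Data.Product using (Σ; _×_; _,_; proj₁; proj₂)
open import Data.Sum using (inj₂)
open import Relation.Binary.PropositionalEquality using (_≡_; subst; sym; trans)

module _ (M : EZFModel) where
  open EZFModel M

  V-P : ∀ Y → V (P Y)
  V-P Y = proj₁ (proj₂ (powerset Y))

  ∈₁⇔∈-P : ∀ Y A → V A → A ∈₁ Y ⇔ A ∈ P Y
  ∈₁⇔∈-P Y = proj₂ (proj₂ (powerset Y))

  P-injective : ∀ {Y Y′} → P Y ≡ P Y′ → Y ≡ Y′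
  P-injective {Y} {Y′} eq = extensionality Y Y′ λ S vS →
    (λ S∈₁Y → proj₂ (∈₁⇔∈-P Y′ S vS) (subst (S ∈_) eq (proj₁ (∈₁⇔∈-P Y S vS) S∈₁Y))) ,
    (λ S∈₁Y′ → proj₂ (∈₁⇔∈-P Y S vS) (subst (S ∈_) (sym eq) (proj₁ (∈₁⇔∈-P Y′ S vS) S∈₁Y′)))

  P-inverse : ∀ {Y Z} → V Z → (∀ A → V A → A ∈ Z ⇔ A ∈₁ Y) → P Y ≡ Z
  P-inverse {Y} {Z} vZ Z⇔Y = zf-ext (V-P Y) vZ λ A vA →
    (λ A∈PY → proj₂ (Z⇔Y A vA) (proj₂ (∈₁⇔∈-P Y A vA) A∈PY)) ,
    (λ A∈Z → proj₁ (∈₁⇔∈-P Y A vA) (proj₁ (Z⇔Y A vA) A∈Z))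

proposition12 : (M : EZFModel) → let open EZFModel M in
    ∀ X → V* X →
    Σ Obj λ Y → InEZF Y × P Y ≡ X × (∀ Y′ → InEZF Y′ → P Y′ ≡ X → Y′ ≡ Y)
proposition12 M X (vX , nonempty) =
  Y , inj₂ (X , (vX , nonempty) , X⇔Y) , PY≡X ,
  λ Y′ _ PY′≡X → P-injective M (trans PY′≡X (sym PY≡X))
  where
  open EZFModel M
  Y : Obj
  Y = proj₁ (inverse-powerset X vX nonempty)
  X⇔Y : ∀ A → V A → A ∈ X ⇔ A ∈₁ Y
  X⇔Y = proj₂ (inverse-powerset X vX nonempty)
  PY≡X : P Y ≡ X
  PY≡X = P-inverse M vX X⇔Y
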